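{- Let $z\ge 0$ be an integer and let $G$ be an undirected multigraph. If $C_1,F_1,\ldots,C_\ell,F_\ell$ is a $z$-antler-sequence for $G$, then for every $1\le i\le\ell$ the pair $(C_1\cup\cdots\cup C_i,\;F_1\cup\cdots\cup F_i)$ is a $z$-antler in $G$.
   Context: Graphs are undirected multigraphs, possibly with self-loops and parallel edges (these count as cycles). A feedback vertex set (FVS) of $G$ is a set $X\subseteq V(G)$ with $G-X$ acyclic; $\mathrm{fvs}(G)$ is its minimum size. For disjoint vertex sets $X,Y$, $e(X,Y)$ is the number of edges between them. A feedback vertex cut (FVC) in $G$ is a pair of disjoint sets $C,F\subseteq V(G)$ such that $G[F]$ is a forest and every tree $T$ of $G[F]$ satisfies $e(V(T),V(G)\setminus(C\cup F))\le1$. An antler is an FVC $(C,F)$ with $|C|\le\mathrm{fvs}(G[C\cup F])$. For $C\subseteq V(G)$, a $C$-certificate is a subgraph $H$ of $G$ such that $C$ is a minimum FVS of $H$; it has order $z$ if every connected component $H'$ of $H$ satisfies $\mathrm{fvs}(H')=|C\cap V(H')|\le z$. A $z$-antler is an antler $(C,F)$ such that $G[C\cup F]$ contains a $C$-certificate of order $z$. A sequence of pairwise disjoint vertex sets $C_1,F_1,\ldots,C_\ell,F_\ell$ is a $z$-antler-sequence for $G$ if for each $1\le i\le\ell$ the pair $(C_i,F_i)$ is a $z$-antler in $G-\bigcup_{j<i}(C_j\cup F_j)$. -}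

module Defs where

open import Data.Nat.Base using (ℕ; zero; suc; _≤_; _<ᵇ_)
open import Data.Bool.Base using (Bool; true; false; _∧_; _∨_)
open import Data.Fin.Base using (Fin; toℕ; inject₁; fromℕ)
open import Data.Fin.Subset using (Subset; _∈_; _∉_; _⊆_; _∩_; _∪_; ∁; ∣_∣; Nonempty; Empty; ⊤)
open import Data.Vec.Base using (lookup; tabulate)
open import Data.List.Base using (allFin)
open import Data.Bool.ListAction using (any)
open import Data.Product using (_×_; _,_; Σ; ∃; proj₁; proj₂)
open import Data.Sum using (_⊎_)
open import Function.Definitions using (Injective)
open import Relation.Binary.PropositionalEquality using (_≡_; _≢_)
open import Relation.Nullary using (¬_)

-- An (ambient) undirected multigraph: vertices Fin n, edges Fin m,
-- each edge has an unordered pair of endpoints (ends e = (u , v));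
-- self-loops (u ≡ v) and parallel edges (distinct e with same ends)
-- are allowed.

record Graph : Set where
  field
    n    : ℕ
    m    : ℕ
    ends : Fin m → Fin n × Fin n

module _ (G : Graph) where
  open Graph G

  record Sub : Set where
    constructor ⟨_,_⟩
    field
      V : Subset n
      E : Subset m
  open Sub public

  Joins : Fin m → Fin n → Fin n → Set
  Joins e u v = (ends e ≡ (u , v)) ⊎ (ends e ≡ (v , u))

  WellFormed : Sub → Set
  WellFormed S = ∀ e → e ∈ E S → lookup (V S) (proj₁ (ends e)) ≡ true
                                × lookup (V S) (proj₂ (ends e)) ≡ true

  _≤Sub_ : Sub → Sub → Set
  H ≤Sub K = WellFormed H × (V H ⊆ V K) × (E H ⊆ E K)

  full : Sub
  full = ⟨ ⊤ , ⊤ ⟩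

  bothIn : Subset n → Fin m → Bool
  bothIn X e = lookup X (proj₁ (ends e)) ∧ lookup X (proj₂ (ends e))

  induced : Sub → Subset n → Sub
  induced S X = ⟨ V S ∩ X , tabulate (λ e → lookup (E S) e ∧ bothIn X e) ⟩

  delete : Sub → Subset n → Sub
  delete S X = induced S (∁ X)

  -- A cycle in S: a closed walk w 0, e 0, w 1, ..., e (L-1), w L = w 0
  -- with L ≥ 1 edges, pairwise distinct edges and pairwise distinct
  -- vertices w 0 … w (L-1).  (L = 1: self-loop; L = 2: parallel edges.)
  record Cycle (S : Sub) : Set where
    field
      k      : ℕ
      w      : Fin (suc (suc k)) → Fin n
      ed     : Fin (suc k) → Fin m
      closed : w (fromℕ (suc k)) ≡ w Data.Fin.Base.zero
      wInj   : Injective _≡_ _≡_ (λ i → w (inject₁ i))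
      edInj  : Injective _≡_ _≡_ ed
      wIn    : ∀ i → w i ∈ V S
      edIn   : ∀ i → ed i ∈ E S
      step   : ∀ i → Joins (ed i) (w (inject₁ i)) (w (Data.Fin.Base.suc i))

  Acyclic : Sub → Set
  Acyclic S = ¬ Cycle S

  IsFVS : Sub → Subset n → Set
  IsFVS S X = (X ⊆ V S) × Acyclic (delete S X)

  FvsAtLeast : Sub → ℕ → Set
  FvsAtLeast S k = ∀ Y → IsFVS S Y → k ≤ ∣ Y ∣

  FvsIs : Sub → ℕ → Set
  FvsIs S k = (Σ (Subset n) λ X → IsFVS S X × ∣ X ∣ ≡ k) × FvsAtLeast S k

  data Reach (S : Sub) : Fin n → Fin n → Set where
    here  : ∀ {v} → Reach S v v
    there : ∀ {u w v} e → e ∈ E S → Joins e u w → Reach S w v → Reach S u v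

  IsComponent : Sub → Subset n → Set
  IsComponent S T =
    Nonempty T × (T ⊆ V S)
    × (∀ {u v} → u ∈ T → v ∈ T → Reach S u v)
    × (∀ {u v} → u ∈ T → v ∈ V S → Reach S u v → v ∈ T)

  crosses : Subset n → Subset n → Fin m → Bool
  crosses X Y e = (lookup X (proj₁ (ends e)) ∧ lookup Y (proj₂ (ends e)))
                ∨ (lookup Y (proj₁ (ends e)) ∧ lookup X (proj₂ (ends e)))

  eCount : Sub → Subset n → Subset n → ℕ
  eCount S X Y = ∣ tabulate (λ e → lookup (E S) e ∧ crosses X Y e) ∣

  Disjoint : Subset n → Subset n → Set
  Disjoint A B = Empty (A ∩ B)

  IsFVC : Sub → Subset n → Subset n → Set
  IsFVC S C F =
    Disjoint C F × (C ⊆ V S) × (F ⊆ V S)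
    × Acyclic (induced S F)
    × (∀ T → IsComponent (induced S F) T
           → eCount S T (V S ∩ ∁ (C ∪ F)) ≤ 1)

  IsAntler : Sub → Subset n → Subset n → Set
  IsAntler S C F = IsFVC S C F × FvsAtLeast (induced S (C ∪ F)) ∣ C ∣

  IsCertificate : ℕ → Subset n → Sub → Set
  IsCertificate z C H =
    IsFVS H C × FvsAtLeast H ∣ C ∣
    × (∀ T → IsComponent H T →
         FvsIs (induced H T) ∣ C ∩ T ∣ × ∣ C ∩ T ∣ ≤ z)

  IsZAntler : ℕ → Sub → Subset n → Subset n → Set
  IsZAntler z S C F =
    IsAntler S C F
    × Σ Sub (λ H → (H ≤Sub induced S (C ∪ F)) × IsCertificate z C H)

  prefixUnion : ∀ {ℓ} → (Fin ℓ → Subset n) → ℕ → Subset n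
  prefixUnion {ℓ} A k =
    tabulate (λ v → any (λ j → (toℕ j <ᵇ k) ∧ lookup (A j) v) (allFin ℓ))

  IsZAntlerSequence : ℕ → (ℓ : ℕ) → (Fin ℓ → Subset n) → (Fin ℓ → Subset n) → Set
  IsZAntlerSequence z ℓ Cs Fs =
    (∀ i j → i ≢ j → Disjoint (Cs i) (Cs j))
    × (∀ i j → i ≢ j → Disjoint (Fs i) (Fs j))
    × (∀ i j → Disjoint (Cs i) (Fs j))
    × (∀ i → IsZAntler z
                (delete full (prefixUnion (λ j → Cs j ∪ Fs j) (toℕ i)))
                (Cs i) (Fs i))

-- By induction along the sequence it suffices to glue two antlers: if (C₁,F₁) is a z-antler in G and
-- (C₂,F₂) is a z-antler in G − (C₁ ∪ F₁), then (C₁ ∪ C₂, F₁ ∪ F₂) is a z-antler in G.  The two certificates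
-- live on disjoint vertex sets, so their union is a certificate for C₁ ∪ C₂ (fvs is additive over a
-- disjoint union, and every component sits in one of the two).  A tree P of G[F₁] has at most one edge
-- into G − (C₁ ∪ F₁), and in particular at most one edge into F₂.  Hence a cycle of G[F₁ ∪ F₂] cannot
-- meet P without staying in it, as it would have to leave P twice; so it lies in G[F₁] or in G₂[F₂].
-- Likewise a tree T of G[F₁ ∪ F₂] with an edge leaving C ∪ F through a tree P of G[F₁] is just P;
-- otherwise T consists of a tree Q of G₂[F₂] together with trees of G[F₁] hanging off Q by their
-- only exit, so every edge leaving C ∪ F from T leaves from Q, and there is at most one such edge.

module Submission where

open import Defs
open import Data.Bool.Base using (Bool; true; false; T; _∧_)
open import Data.Bool.Properties using (T-≡; T-∧; T-∨) renaming (_≟_ to _≟ᵇ_)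
open import Data.Empty using (⊥-elim)
open import Data.Fin.Base using (Fin; zero; suc; toℕ; inject₁; fromℕ; fromℕ<)
open import Data.Fin.Induction using (<-weakInduction)
open import Data.Fin.Properties using (any?; toℕ-injective; toℕ-fromℕ<; toℕ<n) renaming (_≟_ to _≟ᶠ_)
open import Data.Fin.Subset
  using (Subset; _∈_; _∉_; _⊆_; _⊂_; _-_; _∩_; _∪_; ∁; ∣_∣; ⊤; ⊥; ⁅_⁆; Empty; outside; inside)
open import Data.Fin.Subset.Properties
  using ( _∈?_; ∈⊤; ∉⊥; ∣⊥∣≡0; ∣⁅x⁆∣≡1; x∈⁅y⁆⇒x≡y; x∈⁅x⁆; p⊆q⇒∣p∣≤∣q∣; p⊂q⇒∣p∣<∣q∣; ∣p∣≤n
        ; x∈p⇒∣p-x∣<∣p∣; x∈p∧x≢y⇒x∈p-y; nonempty?; Empty-unique; drop-∷-Empty; ⊆-antisym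
        ; x∈p∩q⁺; x∈p∩q⁻; x∈p∪q⁺; x∈p∪q⁻; p⊆p∪q; q⊆p∪q; ∣p∩q∣≤∣p∣; x∈∁p⇒x∉p; x∉p⇒x∈∁p
        ; ∪-comm; ∩-comm )
open import Data.List.Base using (allFin)
open import Data.List.Membership.Propositional using (lose)
open import Data.List.Membership.Propositional.Properties using (∈-allFin)
open import Data.List.Relation.Unary.Any using (satisfied)
open import Data.List.Relation.Unary.Any.Properties using (any⁺; any⁻)
open import Data.Nat.Base using (ℕ; zero; suc; _+_; _≤_; _<_; z≤n; s≤s)
open import Data.Nat.Properties
  using (≤-trans; ≤-reflexive; <-≤-trans; <⇒≤; <⇒≱; n≮0; ≤-pred; m≤n⇒m≤1+n; m≤n⇒m<n∨m≡n; +-suc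
        ; +-monoʳ-≤; +-mono-≤; n≤1+n; <ᵇ⇒<; <⇒<ᵇ)
open import Data.Product using (_×_; _,_; ∃; ∃₂; proj₁; proj₂)
open import Data.Product.Properties using (,-injectiveˡ; ,-injectiveʳ)
open import Data.Sum using (_⊎_; inj₁; inj₂; [_,_]; [_,_]′) renaming (swap to ⊎-swap)
open import Data.Vec.Base using (_∷_; []; here; lookup; tabulate)
open import Data.Vec.Properties using (lookup∘tabulate; []=⇒lookup; lookup⇒[]=)
open import Function using (_∘_)
open import Function.Bundles using (module Equivalence)
open import Relation.Binary.PropositionalEquality
  using (_≡_; _≢_; refl; sym; trans; cong; cong₂; subst; subst₂)
open import Relation.Nullary using (Dec; yes; no; ¬?; decidable-stable; contradiction)
open import Relation.Nullary.Decidable using (isYes; _×-dec_; _⊎-dec_; toWitness; fromWitness)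

open Equivalence using (to; from)

boundary-from-zero : ∀ {n} (g : Fin (suc n) → Bool) {b} j → g zero ≡ b → g j ≢ b
                   → ∃ λ (a : Fin n) → g (inject₁ a) ≡ b × g (suc a) ≢ b
boundary-from-zero g zero g₀ gⱼ = ⊥-elim (gⱼ g₀)
boundary-from-zero {zero} g (suc ())
boundary-from-zero {suc n} g {b} (suc j) g₀ gⱼ with g (suc zero) ≟ᵇ b
... | no g₁≢b = zero , g₀ , g₁≢b
... | yes g₁ = let a , gₐ , gₐ₊₁ = boundary-from-zero (g ∘ suc) j g₁ gⱼ in suc a , gₐ , gₐ₊₁

boundary-to-last : ∀ {n} (g : Fin (suc n) → Bool) {b} i → g i ≡ b → g (fromℕ n) ≢ b
                 → ∃ λ (a : Fin n) → g (inject₁ a) ≡ b × g (suc a) ≢ b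
boundary-to-last {zero} g zero gᵢ gₙ = ⊥-elim (gₙ gᵢ)
boundary-to-last {suc n} g zero gᵢ gₙ = boundary-from-zero g (fromℕ (suc n)) gᵢ gₙ
boundary-to-last {suc n} g (suc i) gᵢ gₙ =
  let a , gₐ , gₐ₊₁ = boundary-to-last (g ∘ suc) i gᵢ gₙ in suc a , gₐ , gₐ₊₁

-- The first boundary leaves the value g zero and the second one returns to it, so they differ.
two-boundaries : ∀ {n} (g : Fin (suc n) → Bool) j → g (fromℕ n) ≡ g zero → g j ≢ g zero
               → ∃₂ λ a a′ → a ≢ a′ × g (inject₁ a) ≢ g (suc a) × g (inject₁ a′) ≢ g (suc a′)
two-boundaries g j closed gⱼ =
  let a , gₐ , gₐ₊₁ = boundary-from-zero g j refl gⱼ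
      a′ , gₐ′ , gₐ′₊₁ = boundary-to-last g j refl (λ e → gⱼ (trans (sym e) closed))
  in a , a′ , (λ a≡a′ → gⱼ (trans (sym gₐ′) (trans (cong (g ∘ inject₁) (sym a≡a′)) gₐ)))
     , (λ e → gₐ₊₁ (trans (sym e) gₐ)) , (λ e → gₐ′₊₁ (trans (sym e) gₐ′))

module _ {k : ℕ} where

  ∈⇒T : ∀ {p : Subset k} {x} → x ∈ p → T (lookup p x)
  ∈⇒T x∈p = from T-≡ ([]=⇒lookup x∈p)

  T⇒∈ : ∀ {p : Subset k} {x} → T (lookup p x) → x ∈ p
  T⇒∈ {p} {x} t = lookup⇒[]= x p (to T-≡ t)

  ∈-tabulate⁺ : ∀ {f : Fin k → Bool} {x} → T (f x) → x ∈ tabulate f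
  ∈-tabulate⁺ {f} {x} t = T⇒∈ (subst T (sym (lookup∘tabulate f x)) t)

  ∈-tabulate⁻ : ∀ {f : Fin k → Bool} {x} → x ∈ tabulate f → T (f x)
  ∈-tabulate⁻ {f} {x} x∈ = subst T (lookup∘tabulate f x) (∈⇒T x∈)

  disjoint⁻ : ∀ {p q : Subset k} {x} → Empty (p ∩ q) → x ∈ p → x ∉ q
  disjoint⁻ d x∈p x∈q = d (_ , x∈p∩q⁺ (x∈p , x∈q))

  disjoint-sym : ∀ {p q : Subset k} → Empty (p ∩ q) → Empty (q ∩ p)
  disjoint-sym {p} {q} = subst Empty (∩-comm p q)

  disjoint-mono : ∀ {p q r s : Subset k} → Empty (p ∩ q) → r ⊆ p → s ⊆ q → Empty (r ∩ s)
  disjoint-mono {r = r} {s} d r⊆p s⊆q (x , x∈) =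
    let x∈r , x∈s = x∈p∩q⁻ r s x∈ in disjoint⁻ d (r⊆p x∈r) (s⊆q x∈s)

  p⊆q⇒q⊆p⊎p⊂q : ∀ {p q : Subset k} → p ⊆ q → q ⊆ p ⊎ p ⊂ q
  p⊆q⇒q⊆p⊎p⊂q {p} {q} p⊆q with any? (λ x → x ∈? q ×-dec ¬? (x ∈? p))
  ... | yes (x , x∈q , x∉p) = inj₂ (p⊆q , x , x∈q , x∉p)
  ... | no none = inj₁ λ {x} x∈q → decidable-stable (x ∈? p) (λ x∉p → none (x , x∈q , x∉p))

  x∈p⇒1≤∣p∣ : ∀ {p : Subset k} {x} → x ∈ p → 1 ≤ ∣ p ∣
  x∈p⇒1≤∣p∣ {x = x} x∈p =
    subst (_≤ _) (∣⁅x⁆∣≡1 x) (p⊆q⇒∣p∣≤∣q∣ λ y∈⁅x⁆ → subst (_∈ _) (sym (x∈⁅y⁆⇒x≡y x y∈⁅x⁆)) x∈p)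

  ∣p∣≤1⇒∈-unique : ∀ {p : Subset k} {x y} → ∣ p ∣ ≤ 1 → x ∈ p → y ∈ p → x ≡ y
  ∣p∣≤1⇒∈-unique {p} {x} {y} ∣p∣≤1 x∈p y∈p with x ≟ᶠ y
  ... | yes x≡y = x≡y
  ... | no x≢y = contradiction ∣p∣≤1 (<⇒≱ (<-≤-trans (s≤s (x∈p⇒1≤∣p∣ y∈p-x)) (x∈p⇒∣p-x∣<∣p∣ x∈p)))
    where
    y∈p-x : y ∈ p - x
    y∈p-x = x∈p∧x≢y⇒x∈p-y y∈p (x≢y ∘ sym)

  ∈-unique⇒∣p∣≤1 : ∀ {p : Subset k} → (∀ {x y} → x ∈ p → y ∈ p → x ≡ y) → ∣ p ∣ ≤ 1
  ∈-unique⇒∣p∣≤1 {p} unique with nonempty? p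
  ... | yes (x , x∈p) =
    subst (_ ≤_) (∣⁅x⁆∣≡1 x) (p⊆q⇒∣p∣≤∣q∣ λ y∈p → subst (_∈ ⁅ x ⁆) (unique x∈p y∈p) (x∈⁅x⁆ x))
  ... | no empty = subst (_≤ 1) (sym (trans (cong ∣_∣ (Empty-unique empty)) (∣⊥∣≡0 k))) z≤n

∣p∪q∣≤∣p∣+∣q∣ : ∀ {k} (p q : Subset k) → ∣ p ∪ q ∣ ≤ ∣ p ∣ + ∣ q ∣
∣p∪q∣≤∣p∣+∣q∣ [] [] = z≤n
∣p∪q∣≤∣p∣+∣q∣ (outside ∷ p) (outside ∷ q) = ∣p∪q∣≤∣p∣+∣q∣ p q
∣p∪q∣≤∣p∣+∣q∣ (outside ∷ p) (inside ∷ q) =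
  ≤-trans (s≤s (∣p∪q∣≤∣p∣+∣q∣ p q)) (≤-reflexive (sym (+-suc ∣ p ∣ ∣ q ∣)))
∣p∪q∣≤∣p∣+∣q∣ (inside ∷ p) (outside ∷ q) = s≤s (∣p∪q∣≤∣p∣+∣q∣ p q)
∣p∪q∣≤∣p∣+∣q∣ (inside ∷ p) (inside ∷ q) = s≤s (≤-trans (∣p∪q∣≤∣p∣+∣q∣ p q) (+-monoʳ-≤ ∣ p ∣ (n≤1+n ∣ q ∣)))

∣p∩q∣+∣p∩r∣≤∣p∣ : ∀ {k} (p q r : Subset k) → Empty (q ∩ r) → ∣ p ∩ q ∣ + ∣ p ∩ r ∣ ≤ ∣ p ∣
∣p∩q∣+∣p∩r∣≤∣p∣ [] [] [] _ = z≤n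
∣p∩q∣+∣p∩r∣≤∣p∣ (outside ∷ p) (_ ∷ q) (_ ∷ r) d = ∣p∩q∣+∣p∩r∣≤∣p∣ p q r (drop-∷-Empty d)
∣p∩q∣+∣p∩r∣≤∣p∣ (inside ∷ p) (inside ∷ q) (inside ∷ r) d = contradiction (zero , here) d
∣p∩q∣+∣p∩r∣≤∣p∣ (inside ∷ p) (inside ∷ q) (outside ∷ r) d = s≤s (∣p∩q∣+∣p∩r∣≤∣p∣ p q r (drop-∷-Empty d))
∣p∩q∣+∣p∩r∣≤∣p∣ (inside ∷ p) (outside ∷ q) (inside ∷ r) d =
  ≤-trans (≤-reflexive (+-suc ∣ p ∩ q ∣ ∣ p ∩ r ∣)) (s≤s (∣p∩q∣+∣p∩r∣≤∣p∣ p q r (drop-∷-Empty d)))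
∣p∩q∣+∣p∩r∣≤∣p∣ (inside ∷ p) (outside ∷ q) (outside ∷ r) d = m≤n⇒m≤1+n (∣p∩q∣+∣p∩r∣≤∣p∣ p q r (drop-∷-Empty d))

[p∪q]∩r≡p∩r : ∀ {k} (p q r : Subset k) → Empty (q ∩ r) → (p ∪ q) ∩ r ≡ p ∩ r
[p∪q]∩r≡p∩r p q r q∩r≡∅ = ⊆-antisym forward backward
  where
  forward : (p ∪ q) ∩ r ⊆ p ∩ r
  forward x∈ =
    let x∈p∪q , x∈r = x∈p∩q⁻ (p ∪ q) r x∈
    in x∈p∩q⁺ ([ (λ x∈p → x∈p) , (λ x∈q → contradiction x∈r (disjoint⁻ q∩r≡∅ x∈q)) ] (x∈p∪q⁻ p q x∈p∪q) , x∈r)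
  backward : p ∩ r ⊆ (p ∪ q) ∩ r
  backward x∈ = let x∈p , x∈r = x∈p∩q⁻ p r x∈ in x∈p∩q⁺ (x∈p∪q⁺ (inj₁ x∈p) , x∈r)

module _ (G : Graph) where
  open Graph G

  Joins-sym : ∀ {e u v} → Joins G e u v → Joins G e v u
  Joins-sym (inj₁ eq) = inj₂ eq
  Joins-sym (inj₂ eq) = inj₁ eq

  Joins-ends : ∀ e → Joins G e (proj₁ (ends e)) (proj₂ (ends e))
  Joins-ends e = inj₁ refl

  Joins-unique : ∀ {e u v x y} → Joins G e u v → Joins G e x y → (u ≡ x × v ≡ y) ⊎ (u ≡ y × v ≡ x)
  Joins-unique (inj₁ p) (inj₁ q) = let eq = trans (sym p) q in inj₁ (,-injectiveˡ eq , ,-injectiveʳ eq)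
  Joins-unique (inj₁ p) (inj₂ q) = let eq = trans (sym p) q in inj₂ (,-injectiveˡ eq , ,-injectiveʳ eq)
  Joins-unique (inj₂ p) (inj₁ q) = let eq = trans (sym p) q in inj₂ (,-injectiveʳ eq , ,-injectiveˡ eq)
  Joins-unique (inj₂ p) (inj₂ q) = let eq = trans (sym p) q in inj₁ (,-injectiveʳ eq , ,-injectiveˡ eq)

  Joins-both : ∀ {e u v x y} (P : Fin n → Set) → Joins G e u v → Joins G e x y → P u → P v → P x × P y
  Joins-both P j j′ Pu Pv with Joins-unique j j′
  ... | inj₁ (refl , refl) = Pu , Pv
  ... | inj₂ (refl , refl) = Pv , Pu

  induced-E⁺ : ∀ {S X e u v} → e ∈ E S → Joins G e u v → u ∈ X → v ∈ X → e ∈ E (induced G S X)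
  induced-E⁺ {X = X} {e} e∈S j u∈X v∈X =
    let p₁∈X , p₂∈X = Joins-both (_∈ X) j (Joins-ends e) u∈X v∈X
    in ∈-tabulate⁺ (from T-∧ (∈⇒T e∈S , from T-∧ (∈⇒T p₁∈X , ∈⇒T p₂∈X)))

  induced-E⁻ : ∀ {S X e u v} → e ∈ E (induced G S X) → Joins G e u v → e ∈ E S × u ∈ X × v ∈ X
  induced-E⁻ {X = X} {e} e∈ j =
    let t , both = to T-∧ (∈-tabulate⁻ e∈)
        t₁ , t₂ = to T-∧ both
    in T⇒∈ t , Joins-both (_∈ X) (Joins-ends e) j (T⇒∈ t₁) (T⇒∈ t₂)

  wf⁺ : ∀ {S} → (∀ {e} → e ∈ E S → proj₁ (ends e) ∈ V S × proj₂ (ends e) ∈ V S) → WellFormed G S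
  wf⁺ ends∈ e e∈ = let a , b = ends∈ e∈ in []=⇒lookup a , []=⇒lookup b

  wf-Joins : ∀ {S e u v} → WellFormed G S → e ∈ E S → Joins G e u v → u ∈ V S × v ∈ V S
  wf-Joins {S} {e} wf e∈ j =
    let a , b = wf e e∈ in Joins-both (_∈ V S) (Joins-ends e) j (lookup⇒[]= _ _ a) (lookup⇒[]= _ _ b)

  wf-full : WellFormed G (full G)
  wf-full = wf⁺ {full G} λ _ → ∈⊤ , ∈⊤

  wf-induced : ∀ {S} X → WellFormed G S → WellFormed G (induced G S X)
  wf-induced {S} X wf = wf⁺ {induced G S X} λ {e} e∈ →
    let e∈S , p₁∈X , p₂∈X = induced-E⁻ {S} {X} e∈ (Joins-ends e)
        p₁∈S , p₂∈S = wf-Joins wf e∈S (Joins-ends e)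
    in x∈p∩q⁺ (p₁∈S , p₁∈X) , x∈p∩q⁺ (p₂∈S , p₂∈X)

  Reach-snoc : ∀ {S u v w e} → Reach G S u v → e ∈ E S → Joins G e v w → Reach G S u w
  Reach-snoc here e∈ j = there _ e∈ j here
  Reach-snoc (there e′ e′∈ j′ r) e∈ j = there e′ e′∈ j′ (Reach-snoc r e∈ j)

  Reach-sym : ∀ {S u v} → Reach G S u v → Reach G S v u
  Reach-sym here = here
  Reach-sym (there e e∈ j r) = Reach-snoc (Reach-sym r) e∈ (Joins-sym j)

  Reach-trans : ∀ {S u v w} → Reach G S u v → Reach G S v w → Reach G S u w
  Reach-trans here r′ = r′
  Reach-trans (there e e∈ j r) r′ = there e e∈ j (Reach-trans r r′)

  Reach-mono : ∀ {S S′} → E S ⊆ E S′ → ∀ {u v} → Reach G S u v → Reach G S′ u v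
  Reach-mono E⊆ here = here
  Reach-mono E⊆ (there e e∈ j r) = there e (E⊆ e∈) j (Reach-mono E⊆ r)

  Reach-preserves : ∀ {S} (P : Fin n → Set) → (∀ {e u w} → e ∈ E S → Joins G e u w → P u → P w)
                  → ∀ {u v} → Reach G S u v → P u → P v
  Reach-preserves P step here Pu = Pu
  Reach-preserves P step (there e e∈ j r) Pu = Reach-preserves P step r (step e∈ j Pu)

  Cycle-transport : ∀ {S S′} (c : Cycle G S)
                  → (∀ i → Cycle.w c i ∈ V S′) → (∀ i → Cycle.ed c i ∈ E S′) → Cycle G S′
  Cycle-transport c w∈ ed∈ = record
    { k = k ; w = w ; ed = ed ; closed = closed ; wInj = wInj ; edInj = edInj
    ; wIn = w∈ ; edIn = ed∈ ; step = step }
    where open Cycle c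

  Cycle-into : ∀ {S S′} (c : Cycle G S) → (∀ i → Cycle.w c i ∈ V S′)
             → (∀ {e u v} → e ∈ E S → Joins G e u v → u ∈ V S′ → v ∈ V S′ → e ∈ E S′) → Cycle G S′
  Cycle-into c w∈ edge = Cycle-transport c w∈ λ i → edge (edIn i) (step i) (w∈ (inject₁ i)) (w∈ (suc i))
    where open Cycle c

  Leaves : Subset n → Fin m → Set
  Leaves A e = ∃₂ λ x y → Joins G e x y × x ∈ A × y ∉ A

  private
    lookup≡false⇒∉ : ∀ {A : Subset n} {x} → lookup A x ≡ false → x ∉ A
    lookup≡false⇒∉ eq x∈A with () ← trans (sym eq) ([]=⇒lookup x∈A)

    lookup-differs⇒Leaves : ∀ {A e u v} → Joins G e u v → lookup A u ≢ lookup A v → Leaves A e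
    lookup-differs⇒Leaves {A} {e} {u} {v} j differs with lookup A u in eu | lookup A v in ev
    ... | true | true = contradiction refl differs
    ... | false | false = contradiction refl differs
    ... | true | false = u , v , j , lookup⇒[]= u A eu , lookup≡false⇒∉ ev
    ... | false | true = v , u , Joins-sym j , lookup⇒[]= v A ev , lookup≡false⇒∉ eu

  Cycle-leaves-twice : ∀ {S} (c : Cycle G S) (A : Subset n) {i j} → Cycle.w c i ∈ A → Cycle.w c j ∉ A
                     → ∃₂ λ a a′ → a ≢ a′ × Leaves A (Cycle.ed c a) × Leaves A (Cycle.ed c a′)
  Cycle-leaves-twice c A {i} {j} wᵢ∈A wⱼ∉A =
    let a , a′ , a≢a′ , dₐ , dₐ′ = two-boundaries (lookup A ∘ w) _ (cong (lookup A) closed) (proj₂ differs)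
    in a , a′ , a≢a′ , lookup-differs⇒Leaves (step a) dₐ , lookup-differs⇒Leaves (step a′) dₐ′
    where
    open Cycle c
    differs : ∃ λ t → lookup A (w t) ≢ lookup A (w zero)
    differs with w zero ∈? A
    ... | yes w₀∈A = j , λ eq → wⱼ∉A (lookup⇒[]= _ A (trans eq ([]=⇒lookup w₀∈A)))
    ... | no w₀∉A = i , λ eq → w₀∉A (lookup⇒[]= _ A (trans (sym eq) ([]=⇒lookup wᵢ∈A)))

  private module _ (S : Sub G) where

    Adjacent : Subset n → Fin m → Fin n → Set
    Adjacent X e v = (proj₁ (ends e) ∈ X × proj₂ (ends e) ≡ v) ⊎ (proj₂ (ends e) ∈ X × proj₁ (ends e) ≡ v)

    Adjacent⇒Joins : ∀ {X e v} → Adjacent X e v → ∃ λ u → u ∈ X × Joins G e u v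
    Adjacent⇒Joins {e = e} (inj₁ (p₁∈X , refl)) = _ , p₁∈X , Joins-ends e
    Adjacent⇒Joins {e = e} (inj₂ (p₂∈X , refl)) = _ , p₂∈X , Joins-sym (Joins-ends e)

    Joins⇒Adjacent : ∀ {X e u v} → u ∈ X → Joins G e u v → Adjacent X e v
    Joins⇒Adjacent {X} {e} u∈X j with Joins-unique (Joins-ends e) j
    ... | inj₁ (p₁≡u , p₂≡v) = inj₁ (subst (_∈ X) (sym p₁≡u) u∈X , p₂≡v)
    ... | inj₂ (p₁≡v , p₂≡u) = inj₂ (subst (_∈ X) (sym p₂≡u) u∈X , p₁≡v)

    adjacent? : ∀ X e v → Dec (Adjacent X e v)
    adjacent? X e v = (proj₁ (ends e) ∈? X ×-dec proj₂ (ends e) ≟ᶠ v)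
                  ⊎-dec (proj₂ (ends e) ∈? X ×-dec proj₁ (ends e) ≟ᶠ v)

    Grown : Subset n → Fin n → Set
    Grown X v = v ∈ X ⊎ ∃ λ e → e ∈ E S × Adjacent X e v

    grown? : ∀ X v → Dec (Grown X v)
    grown? X v = v ∈? X ⊎-dec any? λ e → e ∈? E S ×-dec adjacent? X e v

    grow : Subset n → Subset n
    grow X = tabulate λ v → isYes (grown? X v)

    ⊆-grow : ∀ {X} → X ⊆ grow X
    ⊆-grow {X} {x} x∈X = ∈-tabulate⁺ (fromWitness {a? = grown? X x} (inj₁ x∈X))

    grow-Joins : ∀ {X e u v} → e ∈ E S → Joins G e u v → u ∈ X → v ∈ grow X
    grow-Joins {X} {v = v} e∈S j u∈X =
      ∈-tabulate⁺ (fromWitness {a? = grown? X v} (inj₂ (_ , e∈S , Joins⇒Adjacent u∈X j)))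

    grow⁻ : ∀ {X v} → v ∈ grow X → v ∈ X ⊎ ∃ λ e → e ∈ E S × ∃ λ u → u ∈ X × Joins G e u v
    grow⁻ {X} {v} v∈ with toWitness {a? = grown? X v} (∈-tabulate⁻ v∈)
    ... | inj₁ v∈X = inj₁ v∈X
    ... | inj₂ (e , e∈S , adj) = inj₂ (e , e∈S , Adjacent⇒Joins adj)

    module _ (s : Fin n) where

      ball : ℕ → Subset n
      ball zero = ⁅ s ⁆
      ball (suc r) = grow (ball r)

      s∈ball : ∀ r → s ∈ ball r
      s∈ball zero = x∈⁅x⁆ s
      s∈ball (suc r) = ⊆-grow (s∈ball r)

      ball-Reach : ∀ r {v} → v ∈ ball r → Reach G S s v
      ball-Reach zero v∈ rewrite x∈⁅y⁆⇒x≡y s v∈ = here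
      ball-Reach (suc r) v∈ with grow⁻ v∈
      ... | inj₁ v∈ball = ball-Reach r v∈ball
      ... | inj₂ (e , e∈S , u , u∈ball , j) = Reach-snoc (ball-Reach r u∈ball) e∈S j

      ball-grows : ∀ r → (∃ λ r′ → grow (ball r′) ⊆ ball r′) ⊎ r < ∣ ball r ∣
      ball-grows zero = inj₂ (x∈p⇒1≤∣p∣ (s∈ball zero))
      ball-grows (suc r) with ball-grows r
      ... | inj₁ stable = inj₁ stable
      ... | inj₂ r<∣ball∣ with p⊆q⇒q⊆p⊎p⊂q (⊆-grow {ball r})
      ...   | inj₁ closed = inj₁ (r , closed)
      ...   | inj₂ strict = inj₂ (≤-trans (s≤s r<∣ball∣) (p⊂q⇒∣p∣<∣q∣ strict))

      ball-stabilises : ∃ λ r → grow (ball r) ⊆ ball r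
      ball-stabilises with ball-grows n
      ... | inj₁ stable = stable
      ... | inj₂ n<∣ball∣ = contradiction (∣p∣≤n (ball n)) (<⇒≱ n<∣ball∣)

  component-of : ∀ {S} → WellFormed G S → ∀ {s} → s ∈ V S → ∃ λ T → IsComponent G S T × s ∈ T
  component-of {S} wf {s} s∈S = ball S s r , ((s , s∈ball S s r) , T⊆S , connected , closed) , s∈ball S s r
    where
    r : ℕ
    r = proj₁ (ball-stabilises S s)
    edge-closed : ∀ {e u v} → e ∈ E S → Joins G e u v → u ∈ ball S s r → v ∈ ball S s r
    edge-closed e∈S j u∈ = proj₂ (ball-stabilises S s) (grow-Joins S e∈S j u∈)
    T⊆S : ball S s r ⊆ V S
    T⊆S v∈ = Reach-preserves (_∈ V S) (λ e∈S j _ → proj₂ (wf-Joins wf e∈S j)) (ball-Reach S s r v∈) s∈S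
    connected : ∀ {u v} → u ∈ ball S s r → v ∈ ball S s r → Reach G S u v
    connected u∈ v∈ = Reach-trans (Reach-sym (ball-Reach S s r u∈)) (ball-Reach S s r v∈)
    closed : ∀ {u v} → u ∈ ball S s r → v ∈ V S → Reach G S u v → v ∈ ball S s r
    closed u∈ _ u↝v = Reach-preserves (_∈ ball S s r) edge-closed u↝v u∈

  component-⊆ : ∀ {S T} → IsComponent G S T → T ⊆ V S
  component-⊆ (_ , T⊆S , _) = T⊆S

  component-connected : ∀ {S T u v} → IsComponent G S T → u ∈ T → v ∈ T → Reach G S u v
  component-connected (_ , _ , connected , _) = connected

  component-closed : ∀ {S T e u v} → IsComponent G S T → u ∈ T → e ∈ E S → Joins G e u v → v ∈ V S → v ∈ T
  component-closed (_ , _ , _ , closed) u∈T e∈S j v∈S = closed u∈T v∈S (there _ e∈S j here)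

  Crosses : Sub G → Subset n → Subset n → Fin m → Set
  Crosses S A B e = e ∈ E S × ∃₂ λ a b → Joins G e a b × a ∈ A × b ∈ B

  private
    crossing : Sub G → Subset n → Subset n → Subset m
    crossing S A B = tabulate λ e → lookup (E S) e ∧ crosses G A B e

    Crosses⇒∈ : ∀ {S A B e} → Crosses S A B e → e ∈ crossing S A B
    Crosses⇒∈ {S} {A} {B} {e} (e∈S , a , b , j , a∈A , b∈B) =
      ∈-tabulate⁺ (from T-∧ (∈⇒T e∈S , from T-∨ ends-cross))
      where
      ends-cross : T (lookup A (proj₁ (ends e)) ∧ lookup B (proj₂ (ends e)))
                 ⊎ T (lookup B (proj₁ (ends e)) ∧ lookup A (proj₂ (ends e)))
      ends-cross with Joins-unique j (Joins-ends e)
      ... | inj₁ (refl , refl) = inj₁ (from T-∧ (∈⇒T a∈A , ∈⇒T b∈B))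
      ... | inj₂ (refl , refl) = inj₂ (from T-∧ (∈⇒T b∈B , ∈⇒T a∈A))

    ∈⇒Crosses : ∀ {S A B e} → e ∈ crossing S A B → Crosses S A B e
    ∈⇒Crosses {e = e} e∈ with to T-∧ (∈-tabulate⁻ e∈)
    ... | t , ends-cross with to T-∨ ends-cross
    ...   | inj₁ t′ = let a , b = to T-∧ t′ in T⇒∈ t , _ , _ , Joins-ends e , T⇒∈ a , T⇒∈ b
    ...   | inj₂ t′ = let b , a = to T-∧ t′ in T⇒∈ t , _ , _ , Joins-sym (Joins-ends e) , T⇒∈ a , T⇒∈ b

  Crosses-unique : ∀ {S A B e e′} → eCount G S A B ≤ 1 → Crosses S A B e → Crosses S A B e′ → e ≡ e′
  Crosses-unique {S} {A} {B} count≤1 c c′ =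
    ∣p∣≤1⇒∈-unique count≤1 (Crosses⇒∈ {S} {A} {B} c) (Crosses⇒∈ {S} {A} {B} c′)

  Crosses-unique⇒eCount≤1 : ∀ {S A B} → (∀ {e e′} → Crosses S A B e → Crosses S A B e′ → e ≡ e′)
                          → eCount G S A B ≤ 1
  Crosses-unique⇒eCount≤1 {S} {A} {B} unique =
    ∈-unique⇒∣p∣≤1 λ e∈ e′∈ → unique (∈⇒Crosses {S} {A} {B} e∈) (∈⇒Crosses {S} {A} {B} e′∈)

  IsFVS-restrict : ∀ {H K Y} → WellFormed G H → V H ⊆ V K → E H ⊆ E K → IsFVS G K Y → IsFVS G H (Y ∩ V H)
  IsFVS-restrict {H} {K} {Y} wf V⊆ E⊆ (_ , acyclic) = (λ {v} → proj₂ ∘ x∈p∩q⁻ Y (V H)) , acyclic ∘ lift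
    where
    survives : ∀ {v} → v ∈ V H → v ∈ ∁ (Y ∩ V H) → v ∈ ∁ Y
    survives v∈H v∉ = x∉p⇒x∈∁p λ v∈Y → x∈∁p⇒x∉p v∉ (x∈p∩q⁺ (v∈Y , v∈H))
    lift : Cycle G (delete G H (Y ∩ V H)) → Cycle G (delete G K Y)
    lift c = Cycle-transport c w∈ ed∈
      where
      open Cycle c
      w∈ : ∀ i → w i ∈ V (delete G K Y)
      w∈ i = let w∈H , w∉ = x∈p∩q⁻ (V H) _ (wIn i) in x∈p∩q⁺ (V⊆ w∈H , survives w∈H w∉)
      ed∈ : ∀ i → ed i ∈ E (delete G K Y)
      ed∈ i = let ed∈H , u∉ , v∉ = induced-E⁻ {H} (edIn i) (step i)
                  u∈H , v∈H = wf-Joins wf ed∈H (step i)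
              in induced-E⁺ {K} (E⊆ ed∈H) (step i) (survives u∈H u∉) (survives v∈H v∉)

  FvsAtLeast-mono : ∀ {H K k} → WellFormed G H → V H ⊆ V K → E H ⊆ E K → FvsAtLeast G H k → FvsAtLeast G K k
  FvsAtLeast-mono {H} wf V⊆ E⊆ fvs Y Y-fvs = ≤-trans (fvs _ (IsFVS-restrict wf V⊆ E⊆ Y-fvs)) (∣p∩q∣≤∣p∣ Y (V H))

  ≤Sub⇒FvsAtLeast : ∀ {H K k} → (G ≤Sub H) K → FvsAtLeast G H k → FvsAtLeast G K k
  ≤Sub⇒FvsAtLeast (wf , V⊆ , E⊆) = FvsAtLeast-mono wf V⊆ E⊆

  _∪ˢ_ : Sub G → Sub G → Sub G
  H₁ ∪ˢ H₂ = ⟨ V H₁ ∪ V H₂ , E H₁ ∪ E H₂ ⟩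

  wf-∪ˢ : ∀ {H₁ H₂} → WellFormed G H₁ → WellFormed G H₂ → WellFormed G (H₁ ∪ˢ H₂)
  wf-∪ˢ {H₁} {H₂} wf₁ wf₂ = wf⁺ {H₁ ∪ˢ H₂} ends∈
    where
    ends∈ : ∀ {e} → e ∈ E H₁ ∪ E H₂ → proj₁ (ends e) ∈ V H₁ ∪ V H₂ × proj₂ (ends e) ∈ V H₁ ∪ V H₂
    ends∈ {e} e∈ with x∈p∪q⁻ (E H₁) (E H₂) e∈
    ... | inj₁ e∈₁ = let a , b = wf-Joins wf₁ e∈₁ (Joins-ends e) in x∈p∪q⁺ (inj₁ a) , x∈p∪q⁺ (inj₁ b)
    ... | inj₂ e∈₂ = let a , b = wf-Joins wf₂ e∈₂ (Joins-ends e) in x∈p∪q⁺ (inj₂ a) , x∈p∪q⁺ (inj₂ b)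

  FvsAtLeast-∪ˢ : ∀ {H₁ H₂ k₁ k₂} → WellFormed G H₁ → WellFormed G H₂ → Empty (V H₁ ∩ V H₂)
                → FvsAtLeast G H₁ k₁ → FvsAtLeast G H₂ k₂ → FvsAtLeast G (H₁ ∪ˢ H₂) (k₁ + k₂)
  FvsAtLeast-∪ˢ {H₁} {H₂} wf₁ wf₂ disjoint fvs₁ fvs₂ Y Y-fvs =
    ≤-trans (+-mono-≤ (fvs₁ _ (IsFVS-restrict wf₁ (p⊆p∪q (V H₂)) (p⊆p∪q (E H₂)) Y-fvs))
                      (fvs₂ _ (IsFVS-restrict wf₂ (q⊆p∪q (V H₁) (V H₂)) (q⊆p∪q (E H₁) (E H₂)) Y-fvs)))
            (∣p∩q∣+∣p∩r∣≤∣p∣ Y (V H₁) (V H₂) disjoint)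

  module Summand {H H₁ H₂ : Sub G} (wf₁ : WellFormed G H₁) (wf₂ : WellFormed G H₂)
    (disjoint : Empty (V H₁ ∩ V H₂)) (E⊆ : E H ⊆ E H₁ ∪ E H₂) (V₁⊆ : V H₁ ⊆ V H) (E₁⊆ : E H₁ ⊆ E H) where

    edge : ∀ {e u v} → e ∈ E H → Joins G e u v → u ∈ V H₁ → e ∈ E H₁ × v ∈ V H₁
    edge e∈ j u∈₁ with x∈p∪q⁻ (E H₁) (E H₂) (E⊆ e∈)
    ... | inj₁ e∈₁ = e∈₁ , proj₂ (wf-Joins wf₁ e∈₁ j)
    ... | inj₂ e∈₂ = contradiction (proj₁ (wf-Joins wf₂ e∈₂ j)) (disjoint⁻ disjoint u∈₁)

    Reach-within : ∀ {u v} → u ∈ V H₁ → Reach G H u v → Reach G H₁ u v × v ∈ V H₁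
    Reach-within u∈₁ here = here , u∈₁
    Reach-within u∈₁ (there e e∈ j r) =
      let e∈₁ , w∈₁ = edge e∈ j u∈₁
          r₁ , v∈₁ = Reach-within w∈₁ r
      in there e e∈₁ j r₁ , v∈₁

    Cycle-within : ∀ {Y Y′} → Y′ ⊆ Y → (c : Cycle G (delete G H Y)) → Cycle.w c zero ∈ V H₁
                 → Cycle G (delete G H₁ Y′)
    Cycle-within {Y} {Y′} Y′⊆Y c w₀∈₁ = Cycle-transport c w∈ ed∈
      where
      open Cycle c
      ed∈H : ∀ i → ed i ∈ E H × w (inject₁ i) ∈ ∁ Y × w (suc i) ∈ ∁ Y
      ed∈H i = induced-E⁻ {H} (edIn i) (step i)
      w∈₁ : ∀ i → w i ∈ V H₁
      w∈₁ = <-weakInduction (λ i → w i ∈ V H₁) w₀∈₁ λ i wᵢ∈₁ → proj₂ (edge (proj₁ (ed∈H i)) (step i) wᵢ∈₁)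
      survives : ∀ {v} → v ∈ ∁ Y → v ∈ ∁ Y′
      survives v∉Y = x∉p⇒x∈∁p (x∈∁p⇒x∉p v∉Y ∘ Y′⊆Y)
      w∈ : ∀ i → w i ∈ V (delete G H₁ Y′)
      w∈ i = x∈p∩q⁺ (w∈₁ i , survives (proj₂ (x∈p∩q⁻ (V H) (∁ Y) (wIn i))))
      ed∈ : ∀ i → ed i ∈ E (delete G H₁ Y′)
      ed∈ i = let e∈H , u∉ , v∉ = ed∈H i
              in induced-E⁺ {H₁} (proj₁ (edge e∈H (step i) (w∈₁ (inject₁ i)))) (step i)
                             (survives u∉) (survives v∉)

    component : ∀ {T t} → IsComponent G H T → t ∈ T → t ∈ V H₁
              → IsComponent G H₁ T × induced G H T ≡ induced G H₁ T
    component {T} (nonempty , _ , connected , closed) t∈T t∈₁ =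
      (nonempty , T⊆₁ , connected₁ , closed₁) , cong₂ ⟨_,_⟩ (⊆-antisym V⊆ V⊇) (⊆-antisym E⊆′ E⊇)
      where
      T⊆₁ : T ⊆ V H₁
      T⊆₁ v∈T = proj₂ (Reach-within t∈₁ (connected t∈T v∈T))
      connected₁ : ∀ {u v} → u ∈ T → v ∈ T → Reach G H₁ u v
      connected₁ u∈T v∈T = proj₁ (Reach-within (T⊆₁ u∈T) (connected u∈T v∈T))
      closed₁ : ∀ {u v} → u ∈ T → v ∈ V H₁ → Reach G H₁ u v → v ∈ T
      closed₁ u∈T v∈₁ r = closed u∈T (V₁⊆ v∈₁) (Reach-mono {H₁} {H} E₁⊆ r)
      V⊆ : V H ∩ T ⊆ V H₁ ∩ T
      V⊆ v∈ = let _ , v∈T = x∈p∩q⁻ (V H) T v∈ in x∈p∩q⁺ (T⊆₁ v∈T , v∈T)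
      V⊇ : V H₁ ∩ T ⊆ V H ∩ T
      V⊇ v∈ = let v∈₁ , v∈T = x∈p∩q⁻ (V H₁) T v∈ in x∈p∩q⁺ (V₁⊆ v∈₁ , v∈T)
      E⊆′ : E (induced G H T) ⊆ E (induced G H₁ T)
      E⊆′ {e} e∈ = let e∈H , p₁∈T , p₂∈T = induced-E⁻ {H} {T} e∈ (Joins-ends e)
                   in induced-E⁺ {H₁} (proj₁ (edge e∈H (Joins-ends e) (T⊆₁ p₁∈T))) (Joins-ends e) p₁∈T p₂∈T
      E⊇ : E (induced G H₁ T) ⊆ E (induced G H T)
      E⊇ {e} e∈ = let e∈₁ , p₁∈T , p₂∈T = induced-E⁻ {H₁} {T} e∈ (Joins-ends e)
                  in induced-E⁺ {H} (E₁⊆ e∈₁) (Joins-ends e) p₁∈T p₂∈T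

  IsCertificate-∪ˢ : ∀ {z C₁ C₂ H₁ H₂} → WellFormed G H₁ → WellFormed G H₂ → Empty (V H₁ ∩ V H₂)
                   → IsCertificate G z C₁ H₁ → IsCertificate G z C₂ H₂ → IsCertificate G z (C₁ ∪ C₂) (H₁ ∪ˢ H₂)
  IsCertificate-∪ˢ {z} {C₁} {C₂} {H₁} {H₂} wf₁ wf₂ disjoint
    cert₁@((C₁⊆ , acyclic₁) , fvs₁ , _) cert₂@((C₂⊆ , acyclic₂) , fvs₂ , _) =
    (C⊆ , acyclic) , fvs , bounded
    where
    H : Sub G
    H = H₁ ∪ˢ H₂
    swap : E H ⊆ E H₂ ∪ E H₁
    swap x∈ = x∈p∪q⁺ (⊎-swap (x∈p∪q⁻ (E H₁) (E H₂) x∈))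
    module Left = Summand wf₁ wf₂ disjoint (λ e∈ → e∈) (p⊆p∪q (V H₂)) (p⊆p∪q (E H₂))
    module Right = Summand wf₂ wf₁ (disjoint-sym disjoint) swap (q⊆p∪q (V H₁) (V H₂)) (q⊆p∪q (E H₁) (E H₂))

    C⊆ : C₁ ∪ C₂ ⊆ V H
    C⊆ x∈ = [ x∈p∪q⁺ ∘ inj₁ ∘ C₁⊆ , x∈p∪q⁺ ∘ inj₂ ∘ C₂⊆ ] (x∈p∪q⁻ C₁ C₂ x∈)

    acyclic : Acyclic G (delete G H (C₁ ∪ C₂))
    acyclic c with x∈p∪q⁻ (V H₁) (V H₂) (proj₁ (x∈p∩q⁻ (V H) _ (Cycle.wIn c zero)))
    ... | inj₁ w₀∈₁ = acyclic₁ (Left.Cycle-within (p⊆p∪q C₂) c w₀∈₁)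
    ... | inj₂ w₀∈₂ = acyclic₂ (Right.Cycle-within (q⊆p∪q C₁ C₂) c w₀∈₂)

    fvs : FvsAtLeast G H ∣ C₁ ∪ C₂ ∣
    fvs Y Y-fvs = ≤-trans (∣p∪q∣≤∣p∣+∣q∣ C₁ C₂) (FvsAtLeast-∪ˢ wf₁ wf₂ disjoint fvs₁ fvs₂ Y Y-fvs)

    from-summand : ∀ {T Hᵢ Cᵢ} → IsCertificate G z Cᵢ Hᵢ → IsComponent G Hᵢ T
                 → induced G H T ≡ induced G Hᵢ T → (C₁ ∪ C₂) ∩ T ≡ Cᵢ ∩ T
                 → FvsIs G (induced G H T) ∣ (C₁ ∪ C₂) ∩ T ∣ × ∣ (C₁ ∪ C₂) ∩ T ∣ ≤ z
    from-summand {T} (_ , _ , boundᵢ) compᵢ H≡ C≡ =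
      subst₂ (λ S Z → FvsIs G S ∣ Z ∣ × ∣ Z ∣ ≤ z) (sym H≡) (sym C≡) (boundᵢ T compᵢ)

    bounded : ∀ T → IsComponent G H T → FvsIs G (induced G H T) ∣ (C₁ ∪ C₂) ∩ T ∣ × ∣ (C₁ ∪ C₂) ∩ T ∣ ≤ z
    bounded T comp@((t , t∈T) , T⊆H , _) with x∈p∪q⁻ (V H₁) (V H₂) (T⊆H t∈T)
    ... | inj₁ t∈₁ =
      let comp₁ , H≡ = Left.component comp t∈T t∈₁
      in from-summand cert₁ comp₁ H≡
           ([p∪q]∩r≡p∩r C₁ C₂ T (disjoint-mono (disjoint-sym disjoint) C₂⊆ (component-⊆ comp₁)))
    ... | inj₂ t∈₂ =
      let comp₂ , H≡ = Right.component comp t∈T t∈₂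
      in from-summand cert₂ comp₂ H≡
           (trans (cong (_∩ T) (∪-comm C₁ C₂))
                  ([p∪q]∩r≡p∩r C₂ C₁ T (disjoint-mono disjoint C₁⊆ (component-⊆ comp₂))))

  certified-FVC⇒z-antler : ∀ {z S C F H} → IsFVC G S C F → (G ≤Sub H) (induced G S (C ∪ F))
                         → IsCertificate G z C H → IsZAntler G z S C F
  certified-FVC⇒z-antler fvc H≤ cert@(_ , fvs , _) = (fvc , ≤Sub⇒FvsAtLeast H≤ fvs) , _ , H≤ , cert

  module FvcUnion {C₁ F₁ C₂ F₂ : Subset n}
    (fvc₁ : IsFVC G (full G) C₁ F₁)
    (fvc₂ : IsFVC G (delete G (full G) (C₁ ∪ F₁)) C₂ F₂) where

    X C F : Subset n
    X = C₁ ∪ F₁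
    C = C₁ ∪ C₂
    F = F₁ ∪ F₂

    G₂ G[F₁] G₂[F₂] G[F] : Sub G
    G₂ = delete G (full G) X
    G[F₁] = induced G (full G) F₁
    G₂[F₂] = induced G G₂ F₂
    G[F] = induced G (full G) F

    private
      C₁∩F₁≡∅ : Empty (C₁ ∩ F₁)
      C₁∩F₁≡∅ = proj₁ fvc₁
      acyclic₁ : Acyclic G G[F₁]
      acyclic₁ = proj₁ (proj₂ (proj₂ (proj₂ fvc₁)))
      count₁ : ∀ P → IsComponent G G[F₁] P → eCount G (full G) P (⊤ ∩ ∁ X) ≤ 1
      count₁ = proj₂ (proj₂ (proj₂ (proj₂ fvc₁)))
      C₂∩F₂≡∅ : Empty (C₂ ∩ F₂)
      C₂∩F₂≡∅ = proj₁ fvc₂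
      C₂⊆G₂ : C₂ ⊆ V G₂
      C₂⊆G₂ = proj₁ (proj₂ fvc₂)
      F₂⊆G₂ : F₂ ⊆ V G₂
      F₂⊆G₂ = proj₁ (proj₂ (proj₂ fvc₂))
      acyclic₂ : Acyclic G G₂[F₂]
      acyclic₂ = proj₁ (proj₂ (proj₂ (proj₂ fvc₂)))
      count₂ : ∀ Q → IsComponent G G₂[F₂] Q → eCount G G₂ Q (V G₂ ∩ ∁ (C₂ ∪ F₂)) ≤ 1
      count₂ = proj₂ (proj₂ (proj₂ (proj₂ fvc₂)))

    C₂∉X : ∀ {v} → v ∈ C₂ → v ∉ X
    C₂∉X v∈ = x∈∁p⇒x∉p (proj₂ (x∈p∩q⁻ ⊤ (∁ X) (C₂⊆G₂ v∈)))

    F₂∉X : ∀ {v} → v ∈ F₂ → v ∉ X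
    F₂∉X v∈ = x∈∁p⇒x∉p (proj₂ (x∈p∩q⁻ ⊤ (∁ X) (F₂⊆G₂ v∈)))

    F₂∉F₁ : ∀ {v} → v ∈ F₂ → v ∉ F₁
    F₂∉F₁ v∈F₂ = F₂∉X v∈F₂ ∘ x∈p∪q⁺ ∘ inj₂

    F∉C₁ : ∀ {v} → v ∈ F → v ∉ C₁
    F∉C₁ v∈F v∈C₁ with x∈p∪q⁻ F₁ F₂ v∈F
    ... | inj₁ v∈F₁ = disjoint⁻ C₁∩F₁≡∅ v∈C₁ v∈F₁
    ... | inj₂ v∈F₂ = F₂∉X v∈F₂ (x∈p∪q⁺ (inj₁ v∈C₁))

    module Outside {v} (v∉ : v ∉ C ∪ F) where
      ∉F : v ∉ F
      ∉F = v∉ ∘ x∈p∪q⁺ ∘ inj₂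
      ∉C₁ : v ∉ C₁
      ∉C₁ = v∉ ∘ x∈p∪q⁺ ∘ inj₁ ∘ x∈p∪q⁺ ∘ inj₁
      ∉X : v ∉ X
      ∉X v∈X = [ ∉C₁ , ∉F ∘ x∈p∪q⁺ ∘ inj₁ ] (x∈p∪q⁻ C₁ F₁ v∈X)
      ∉C₂∪F₂ : v ∉ C₂ ∪ F₂
      ∉C₂∪F₂ v∈ = [ v∉ ∘ x∈p∪q⁺ ∘ inj₁ ∘ x∈p∪q⁺ ∘ inj₂ , ∉F ∘ x∈p∪q⁺ ∘ inj₂ ] (x∈p∪q⁻ C₂ F₂ v∈)

    edge-G₂ : ∀ {e u v} → Joins G e u v → u ∉ X → v ∉ X → e ∈ E G₂
    edge-G₂ j u∉ v∉ = induced-E⁺ {full G} ∈⊤ j (x∉p⇒x∈∁p u∉) (x∉p⇒x∈∁p v∉)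

    edge-G[F₁] : ∀ {e u v} → Joins G e u v → u ∈ F₁ → v ∈ F₁ → e ∈ E G[F₁]
    edge-G[F₁] = induced-E⁺ {full G} ∈⊤

    edge-G₂[F₂] : ∀ {e u v} → Joins G e u v → u ∈ F₂ → v ∈ F₂ → e ∈ E G₂[F₂]
    edge-G₂[F₂] j u∈ v∈ = induced-E⁺ {G₂} (edge-G₂ j (F₂∉X u∈) (F₂∉X v∈)) j u∈ v∈

    vertex-G₂ : ∀ {v} → v ∉ X → v ∈ V G₂
    vertex-G₂ v∉ = x∈p∩q⁺ (∈⊤ , x∉p⇒x∈∁p v∉)

    tree₁ : ∀ {v} → v ∈ F₁ → ∃ λ P → IsComponent G G[F₁] P × v ∈ P
    tree₁ v∈ = component-of (wf-induced {full G} F₁ wf-full) (x∈p∩q⁺ (∈⊤ , v∈))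

    tree₂ : ∀ {v} → v ∈ F₂ → ∃ λ Q → IsComponent G G₂[F₂] Q × v ∈ Q
    tree₂ v∈ = component-of (wf-induced {G₂} F₂ (wf-induced {full G} (∁ X) wf-full))
                            (x∈p∩q⁺ (vertex-G₂ (F₂∉X v∈) , v∈))

    tree₁⊆F₁ : ∀ {P} → IsComponent G G[F₁] P → P ⊆ F₁
    tree₁⊆F₁ cp = proj₂ ∘ x∈p∩q⁻ ⊤ F₁ ∘ component-⊆ cp

    tree₂⊆F₂ : ∀ {Q} → IsComponent G G₂[F₂] Q → Q ⊆ F₂
    tree₂⊆F₂ cq = proj₂ ∘ x∈p∩q⁻ (V G₂) F₂ ∘ component-⊆ cq

    Exit : Subset n → Fin m → Set
    Exit P e = ∃₂ λ p q → Joins G e p q × p ∈ P × q ∉ P × q ∉ C₁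

    -- Such an edge cannot end in F₁ (that end would lie in P), so it is counted by the bound of (C₁,F₁).
    Exit-unique : ∀ {P e e′} → IsComponent G G[F₁] P → Exit P e → Exit P e′ → e ≡ e′
    Exit-unique {P} cp x x′ = Crosses-unique {full G} (count₁ P cp) (Exit⇒Crosses x) (Exit⇒Crosses x′)
      where
      Exit⇒Crosses : ∀ {e} → Exit P e → Crosses (full G) P (⊤ ∩ ∁ X) e
      Exit⇒Crosses (p , q , j , p∈P , q∉P , q∉C₁) = ∈⊤ , p , q , j , p∈P , vertex-G₂ q∉X
        where
        q∉X : q ∉ X
        q∉X q∈X = [ q∉C₁ , (λ q∈F₁ → q∉P (component-closed cp p∈P (edge-G[F₁] j (tree₁⊆F₁ cp p∈P) q∈F₁) j
                                                          (x∈p∩q⁺ (∈⊤ , q∈F₁)))) ] (x∈p∪q⁻ C₁ F₁ q∈X)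

    Leaves⇒Exit : ∀ {P e} → e ∈ E G[F] → Leaves P e → Exit P e
    Leaves⇒Exit e∈ (x , y , j , x∈P , y∉P) =
      x , y , j , x∈P , y∉P , F∉C₁ (proj₂ (proj₂ (induced-E⁻ {full G} {F} e∈ j)))

    Out⇒Exit : ∀ {P e a r} → IsComponent G G[F₁] P → Joins G e a r → a ∈ P → r ∉ C ∪ F → Exit P e
    Out⇒Exit cp j a∈P r∉ = _ , _ , j , a∈P , Outside.∉F r∉ ∘ x∈p∪q⁺ ∘ inj₁ ∘ tree₁⊆F₁ cp , Outside.∉C₁ r∉

    acyclic : Acyclic G G[F]
    acyclic c with any? (λ i → w i ∈? F₁)
      where open Cycle c
    ... | no none = acyclic₂ (Cycle-into c w∈G₂[F₂] λ e∈ j u∈ v∈ → edge-G₂[F₂] j (in-F₂ u∈) (in-F₂ v∈))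
      where
      open Cycle c
      in-F₂ : ∀ {v} → v ∈ V G₂[F₂] → v ∈ F₂
      in-F₂ = proj₂ ∘ x∈p∩q⁻ (V G₂) F₂
      w∈G₂[F₂] : ∀ i → w i ∈ V G₂[F₂]
      w∈G₂[F₂] i with x∈p∪q⁻ F₁ F₂ (proj₂ (x∈p∩q⁻ ⊤ F (wIn i)))
      ... | inj₁ wᵢ∈F₁ = contradiction (i , wᵢ∈F₁) none
      ... | inj₂ wᵢ∈F₂ = x∈p∩q⁺ (vertex-G₂ (F₂∉X wᵢ∈F₂) , wᵢ∈F₂)
    ... | yes (j , wⱼ∈F₁) with tree₁ wⱼ∈F₁
    ...   | P , cp , wⱼ∈P with any? (λ i → ¬? (Cycle.w c i ∈? P))
    ...     | no none = acyclic₁ (Cycle-into c w∈G[F₁] λ e∈ j u∈ v∈ → edge-G[F₁] j (in-F₁ u∈) (in-F₁ v∈))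
      where
      open Cycle c
      in-F₁ : ∀ {v} → v ∈ V G[F₁] → v ∈ F₁
      in-F₁ = proj₂ ∘ x∈p∩q⁻ ⊤ F₁
      w∈G[F₁] : ∀ i → w i ∈ V G[F₁]
      w∈G[F₁] i = component-⊆ cp (decidable-stable (w i ∈? P) λ wᵢ∉P → none (i , wᵢ∉P))
    ...     | yes (i , wᵢ∉P) =
      let a , a′ , a≢a′ , leaves , leaves′ = Cycle-leaves-twice c P wⱼ∈P wᵢ∉P
      in a≢a′ (edInj (Exit-unique cp (Leaves⇒Exit (edIn a) leaves) (Leaves⇒Exit (edIn a′) leaves′)))
      where open Cycle c

    -- A tree of G[F₁] with an edge leaving C ∪ F has no other exit, so no edge of G[F] leaves it.
    tree₁-closed : ∀ {P e a r} → IsComponent G G[F₁] P → Joins G e a r → a ∈ P → r ∉ C ∪ F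
                 → ∀ {u v} → Reach G G[F] u v → u ∈ P → v ∈ P
    tree₁-closed {P} cp jₑ a∈P r∉ = Reach-preserves (_∈ P) step
      where
      step : ∀ {g u w} → g ∈ E G[F] → Joins G g u w → u ∈ P → w ∈ P
      step {g} {u} {w} g∈ j u∈P = decidable-stable (w ∈? P) λ w∉P →
        let g≡e = Exit-unique cp (Leaves⇒Exit g∈ (u , w , j , u∈P , w∉P)) (Out⇒Exit cp jₑ a∈P r∉)
            _ , u∈F , w∈F = induced-E⁻ {full G} {F} g∈ j
        in Outside.∉F r∉ (proj₂ (Joins-both (_∈ F) j (subst (λ x → Joins G x _ _) (sym g≡e) jₑ) u∈F w∈F))

    Attached : Subset n → Fin n → Set
    Attached Q v = ∃₂ λ P f → IsComponent G G[F₁] P × v ∈ P × ∃₂ λ p q → Joins G f p q × p ∈ P × q ∈ Q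

    attachment-Exit : ∀ {P Q f p q} → IsComponent G G[F₁] P → IsComponent G G₂[F₂] Q
                    → Joins G f p q → p ∈ P → q ∈ Q → Exit P f
    attachment-Exit cp cq jf p∈P q∈Q =
      let q∈F₂ = tree₂⊆F₂ cq q∈Q in
      _ , _ , jf , p∈P , F₂∉F₁ q∈F₂ ∘ tree₁⊆F₁ cp , F∉C₁ (x∈p∪q⁺ (inj₂ q∈F₂))

    -- Inside G[F] one cannot get from a tree Q of G₂[F₂] beyond Q and the trees of G[F₁] attached to it:
    -- an attached tree has spent its only exit on the edge to Q.
    region-closed : ∀ {Q} → IsComponent G G₂[F₂] Q
                  → ∀ {u v} → Reach G G[F] u v → u ∈ Q ⊎ Attached Q u → v ∈ Q ⊎ Attached Q v
    region-closed {Q} cq = Reach-preserves _ step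
      where
      step : ∀ {g u w} → g ∈ E G[F] → Joins G g u w → u ∈ Q ⊎ Attached Q u → w ∈ Q ⊎ Attached Q w
      step g∈ j region with x∈p∪q⁻ F₁ F₂ (proj₂ (proj₂ (induced-E⁻ {full G} {F} g∈ j)))
      step g∈ j (inj₁ u∈Q) | inj₁ w∈F₁ =
        let P , cp , w∈P = tree₁ w∈F₁ in inj₂ (P , _ , cp , w∈P , _ , _ , Joins-sym j , w∈P , u∈Q)
      step g∈ j (inj₁ u∈Q) | inj₂ w∈F₂ =
        inj₁ (component-closed cq u∈Q (edge-G₂[F₂] j (tree₂⊆F₂ cq u∈Q) w∈F₂) j
                               (x∈p∩q⁺ (vertex-G₂ (F₂∉X w∈F₂) , w∈F₂)))
      step g∈ j (inj₂ (P , f , cp , u∈P , attachment)) | inj₁ w∈F₁ =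
        inj₂ (P , f , cp , component-closed cp u∈P (edge-G[F₁] j (tree₁⊆F₁ cp u∈P) w∈F₁) j (x∈p∩q⁺ (∈⊤ , w∈F₁))
             , attachment)
      step {u = u} {w} g∈ j (inj₂ (P , f , cp , u∈P , p , q , jf , p∈P , q∈Q)) | inj₂ w∈F₂
        with Exit-unique cp (u , w , j , u∈P , F₂∉F₁ w∈F₂ ∘ tree₁⊆F₁ cp , F∉C₁ (x∈p∪q⁺ (inj₂ w∈F₂)))
                            (attachment-Exit cp cq jf p∈P q∈Q)
      ... | refl with Joins-unique j jf
      ...   | inj₁ (_ , refl) = inj₁ q∈Q
      ...   | inj₂ (_ , refl) = contradiction (tree₁⊆F₁ cp p∈P) (F₂∉F₁ w∈F₂)

    exits-unique-from-F₁ : ∀ {a b e e′ r r′} → a ∈ F₁ → Reach G G[F] a b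
                         → Joins G e a r → r ∉ C ∪ F → Joins G e′ b r′ → r′ ∉ C ∪ F → e ≡ e′
    exits-unique-from-F₁ a∈F₁ a↝b j r∉ j′ r′∉ =
      let P , cp , a∈P = tree₁ a∈F₁
      in Exit-unique cp (Out⇒Exit cp j a∈P r∉) (Out⇒Exit cp j′ (tree₁-closed cp j a∈P r∉ a↝b a∈P) r′∉)

    exits-unique-from-F₂ : ∀ {a b e e′ r r′} → a ∈ F₂ → Reach G G[F] a b
                         → Joins G e a r → r ∉ C ∪ F → Joins G e′ b r′ → r′ ∉ C ∪ F → e ≡ e′
    exits-unique-from-F₂ a∈F₂ a↝b j r∉ j′ r′∉ with tree₂ a∈F₂
    ... | Q , cq , a∈Q with region-closed cq a↝b (inj₁ a∈Q)
    ...   | inj₁ b∈Q = Crosses-unique {G₂} (count₂ Q cq) (leaves-Q a∈Q j r∉) (leaves-Q b∈Q j′ r′∉)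
      where
      leaves-Q : ∀ {e a r} → a ∈ Q → Joins G e a r → r ∉ C ∪ F → Crosses G₂ Q (V G₂ ∩ ∁ (C₂ ∪ F₂)) e
      leaves-Q a∈Q j r∉ =
        edge-G₂ j (F₂∉X (tree₂⊆F₂ cq a∈Q)) (Outside.∉X r∉) , _ , _ , j , a∈Q
        , x∈p∩q⁺ (vertex-G₂ (Outside.∉X r∉) , x∉p⇒x∈∁p (Outside.∉C₂∪F₂ r∉))
    ...   | inj₂ (P , f , cp , b∈P , p , q , jf , p∈P , q∈Q)
      with Exit-unique cp (Out⇒Exit cp j′ b∈P r′∉) (attachment-Exit cp cq jf p∈P q∈Q)
    ...     | refl =
      let p∈F = x∈p∪q⁺ (inj₁ (tree₁⊆F₁ cp p∈P)) ; q∈F = x∈p∪q⁺ (inj₂ (tree₂⊆F₂ cq q∈Q))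
      in contradiction (proj₂ (Joins-both (_∈ F) jf j′ p∈F q∈F)) (Outside.∉F r′∉)

    count : ∀ T → IsComponent G G[F] T → eCount G (full G) T (⊤ ∩ ∁ (C ∪ F)) ≤ 1
    count T ct = Crosses-unique⇒eCount≤1 {full G} unique
      where
      ∉C∪F : ∀ {v} → v ∈ ⊤ ∩ ∁ (C ∪ F) → v ∉ C ∪ F
      ∉C∪F = x∈∁p⇒x∉p ∘ proj₂ ∘ x∈p∩q⁻ ⊤ (∁ (C ∪ F))
      unique : ∀ {e e′} → Crosses (full G) T (⊤ ∩ ∁ (C ∪ F)) e → Crosses (full G) T (⊤ ∩ ∁ (C ∪ F)) e′ → e ≡ e′
      unique (_ , a , r , j , a∈T , r∈) (_ , b , r′ , j′ , b∈T , r′∈)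
        with x∈p∪q⁻ F₁ F₂ (proj₂ (x∈p∩q⁻ ⊤ F (component-⊆ ct a∈T)))
      ... | inj₁ a∈F₁ = exits-unique-from-F₁ a∈F₁ (component-connected ct a∈T b∈T) j (∉C∪F r∈) j′ (∉C∪F r′∈)
      ... | inj₂ a∈F₂ = exits-unique-from-F₂ a∈F₂ (component-connected ct a∈T b∈T) j (∉C∪F r∈) j′ (∉C∪F r′∈)

    disjoint : Empty (C ∩ F)
    disjoint (v , v∈) with x∈p∩q⁻ C F v∈
    ... | v∈C , v∈F with x∈p∪q⁻ C₁ C₂ v∈C | x∈p∪q⁻ F₁ F₂ v∈F
    ...   | inj₁ v∈C₁ | _ = F∉C₁ v∈F v∈C₁
    ...   | inj₂ v∈C₂ | inj₁ v∈F₁ = C₂∉X v∈C₂ (x∈p∪q⁺ (inj₂ v∈F₁))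
    ...   | inj₂ v∈C₂ | inj₂ v∈F₂ = disjoint⁻ C₂∩F₂≡∅ v∈C₂ v∈F₂

    isFVC : IsFVC G (full G) C F
    isFVC = disjoint , (λ _ → ∈⊤) , (λ _ → ∈⊤) , acyclic , count

  z-antler-∪ : ∀ {z C₁ F₁ C₂ F₂}
             → IsZAntler G z (full G) C₁ F₁ → IsZAntler G z (delete G (full G) (C₁ ∪ F₁)) C₂ F₂
             → IsZAntler G z (full G) (C₁ ∪ C₂) (F₁ ∪ F₂)
  z-antler-∪ {z} {C₁} {F₁} {C₂} {F₂}
    ((fvc₁ , _) , H₁ , (wf₁ , V₁⊆ , _) , cert₁) ((fvc₂ , _) , H₂ , (wf₂ , V₂⊆ , _) , cert₂) =
    certified-FVC⇒z-antler {S = full G} {H = H} isFVC H≤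
      (IsCertificate-∪ˢ {H₁ = H₁} {H₂} wf₁ wf₂ H₁∩H₂≡∅ cert₁ cert₂)
    where
    open FvcUnion fvc₁ fvc₂ using (X; G₂; isFVC; C₂∉X; F₂∉X)
    H : Sub G
    H = H₁ ∪ˢ H₂
    H₁⊆X : V H₁ ⊆ X
    H₁⊆X = proj₂ ∘ x∈p∩q⁻ ⊤ X ∘ V₁⊆
    H₂⊆C₂∪F₂ : V H₂ ⊆ C₂ ∪ F₂
    H₂⊆C₂∪F₂ = proj₂ ∘ x∈p∩q⁻ (V G₂) (C₂ ∪ F₂) ∘ V₂⊆
    H₁∩H₂≡∅ : Empty (V H₁ ∩ V H₂)
    H₁∩H₂≡∅ = disjoint-mono X∩C₂F₂≡∅ H₁⊆X H₂⊆C₂∪F₂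
      where
      X∩C₂F₂≡∅ : Empty (X ∩ (C₂ ∪ F₂))
      X∩C₂F₂≡∅ (v , v∈) = let v∈X , v∈C₂F₂ = x∈p∩q⁻ X (C₂ ∪ F₂) v∈ in [ C₂∉X , F₂∉X ]′ (x∈p∪q⁻ C₂ F₂ v∈C₂F₂) v∈X
    H⊆C∪F : V H ⊆ (C₁ ∪ C₂) ∪ (F₁ ∪ F₂)
    H⊆C∪F v∈ with x∈p∪q⁻ (V H₁) (V H₂) v∈
    ... | inj₁ v∈₁ =
      [ x∈p∪q⁺ ∘ inj₁ ∘ x∈p∪q⁺ ∘ inj₁ , x∈p∪q⁺ ∘ inj₂ ∘ x∈p∪q⁺ ∘ inj₁ ] (x∈p∪q⁻ C₁ F₁ (H₁⊆X v∈₁))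
    ... | inj₂ v∈₂ =
      [ x∈p∪q⁺ ∘ inj₁ ∘ x∈p∪q⁺ ∘ inj₂ , x∈p∪q⁺ ∘ inj₂ ∘ x∈p∪q⁺ ∘ inj₂ ] (x∈p∪q⁻ C₂ F₂ (H₂⊆C₂∪F₂ v∈₂))
    H≤ : (G ≤Sub H) (induced G (full G) ((C₁ ∪ C₂) ∪ (F₁ ∪ F₂)))
    H≤ = wf , (λ v∈ → x∈p∩q⁺ (∈⊤ , H⊆C∪F v∈)) , λ {e} e∈ →
      let p₁∈ , p₂∈ = wf-Joins {H} wf e∈ (Joins-ends e)
      in induced-E⁺ {full G} ∈⊤ (Joins-ends e) (H⊆C∪F p₁∈) (H⊆C∪F p₂∈)
      where
      wf : WellFormed G H
      wf = wf-∪ˢ {H₁} {H₂} wf₁ wf₂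

  empty-z-antler : ∀ z → IsZAntler G z (full G) ⊥ ⊥
  empty-z-antler z = certified-FVC⇒z-antler {S = full G} {H = H₀} fvc H≤ cert
    where
    H₀ : Sub G
    H₀ = ⟨ ⊥ , ⊥ ⟩
    fvc : IsFVC G (full G) ⊥ ⊥
    fvc = (λ (_ , v∈) → ∉⊥ (proj₁ (x∈p∩q⁻ ⊥ ⊥ v∈))) , (λ _ → ∈⊤) , (λ _ → ∈⊤)
        , (λ c → ∉⊥ (proj₂ (x∈p∩q⁻ ⊤ ⊥ (Cycle.wIn c zero))))
        , λ _ ((_ , t∈T) , T⊆ , _) → ⊥-elim (∉⊥ (proj₂ (x∈p∩q⁻ ⊤ ⊥ (T⊆ t∈T))))
    H≤ : (G ≤Sub H₀) (induced G (full G) (⊥ ∪ ⊥))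
    H≤ = wf⁺ {H₀} (λ e∈ → ⊥-elim (∉⊥ e∈)) , (λ v∈ → ⊥-elim (∉⊥ v∈)) , (λ e∈ → ⊥-elim (∉⊥ e∈))
    cert : IsCertificate G z ⊥ H₀
    cert = ((λ v∈ → v∈) , λ c → ∉⊥ (proj₁ (x∈p∩q⁻ ⊥ (∁ ⊥) (Cycle.wIn c zero))))
         , (λ Y _ → subst (_≤ ∣ Y ∣) (sym (∣⊥∣≡0 n)) z≤n)
         , λ _ ((_ , t∈T) , T⊆ , _) → ⊥-elim (∉⊥ (T⊆ t∈T))

  module _ {ℓ : ℕ} where

    ∈-prefixUnion⁺ : ∀ {A : Fin ℓ → Subset n} {k j v} → toℕ j < k → v ∈ A j → v ∈ prefixUnion G A k
    ∈-prefixUnion⁺ {j = j} j<k v∈ = ∈-tabulate⁺ (any⁺ _ (lose (∈-allFin j) (from T-∧ (<⇒<ᵇ j<k , ∈⇒T v∈))))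

    ∈-prefixUnion⁻ : ∀ {A : Fin ℓ → Subset n} {k v} → v ∈ prefixUnion G A k → ∃ λ j → toℕ j < k × v ∈ A j
    ∈-prefixUnion⁻ {k = k} v∈ =
      let j , t = satisfied (any⁻ _ (allFin ℓ) (∈-tabulate⁻ v∈))
          j<ᵇk , v∈Aⱼ = to T-∧ t
      in j , <ᵇ⇒< _ k j<ᵇk , T⇒∈ v∈Aⱼ

    prefixUnion-zero : ∀ (A : Fin ℓ → Subset n) → prefixUnion G A 0 ≡ ⊥
    prefixUnion-zero A = ⊆-antisym (λ v∈ → let _ , j<0 , _ = ∈-prefixUnion⁻ {A} v∈ in contradiction j<0 n≮0)
                                   (λ v∈ → contradiction v∈ ∉⊥)

    prefixUnion-suc : ∀ (A : Fin ℓ → Subset n) {k} i → toℕ i ≡ k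
                    → prefixUnion G A (suc k) ≡ prefixUnion G A k ∪ A i
    prefixUnion-suc A {k} i i≡k = ⊆-antisym forward backward
      where
      forward : prefixUnion G A (suc k) ⊆ prefixUnion G A k ∪ A i
      forward v∈ with ∈-prefixUnion⁻ {A} {suc k} v∈
      ... | j , j<1+k , v∈Aⱼ with m≤n⇒m<n∨m≡n (≤-pred j<1+k)
      ...   | inj₁ j<k = x∈p∪q⁺ (inj₁ (∈-prefixUnion⁺ {A} j<k v∈Aⱼ))
      ...   | inj₂ j≡k = x∈p∪q⁺ (inj₂ (subst (λ j → _ ∈ A j) (toℕ-injective (trans j≡k (sym i≡k))) v∈Aⱼ))
      backward : prefixUnion G A k ∪ A i ⊆ prefixUnion G A (suc k)
      backward v∈ with x∈p∪q⁻ (prefixUnion G A k) (A i) v∈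
      ... | inj₁ v∈pre = let j , j<k , v∈Aⱼ = ∈-prefixUnion⁻ {A} {k} v∈pre
                         in ∈-prefixUnion⁺ {A} (m≤n⇒m≤1+n j<k) v∈Aⱼ
      ... | inj₂ v∈Aᵢ = ∈-prefixUnion⁺ {A} (s≤s (≤-reflexive i≡k)) v∈Aᵢ

    prefixUnion-∪ : ∀ (A B : Fin ℓ → Subset n) k
                  → prefixUnion G (λ j → A j ∪ B j) k ≡ prefixUnion G A k ∪ prefixUnion G B k
    prefixUnion-∪ A B k = ⊆-antisym forward backward
      where
      forward : prefixUnion G (λ j → A j ∪ B j) k ⊆ prefixUnion G A k ∪ prefixUnion G B k
      forward v∈ with ∈-prefixUnion⁻ {λ j → A j ∪ B j} {k} v∈
      ... | j , j<k , v∈A∪B with x∈p∪q⁻ (A j) (B j) v∈A∪B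
      ...   | inj₁ v∈A = x∈p∪q⁺ (inj₁ (∈-prefixUnion⁺ {A} j<k v∈A))
      ...   | inj₂ v∈B = x∈p∪q⁺ (inj₂ (∈-prefixUnion⁺ {B} j<k v∈B))
      backward : prefixUnion G A k ∪ prefixUnion G B k ⊆ prefixUnion G (λ j → A j ∪ B j) k
      backward v∈ with x∈p∪q⁻ (prefixUnion G A k) (prefixUnion G B k) v∈
      ... | inj₁ v∈A = let j , j<k , v∈Aⱼ = ∈-prefixUnion⁻ {A} {k} v∈A
                       in ∈-prefixUnion⁺ {λ j → A j ∪ B j} j<k (x∈p∪q⁺ (inj₁ v∈Aⱼ))
      ... | inj₂ v∈B = let j , j<k , v∈Bⱼ = ∈-prefixUnion⁻ {B} {k} v∈B
                       in ∈-prefixUnion⁺ {λ j → A j ∪ B j} j<k (x∈p∪q⁺ (inj₂ v∈Bⱼ))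

  prefix-z-antler : ∀ {z ℓ Cs Fs} → IsZAntlerSequence G z ℓ Cs Fs
                  → ∀ k → k ≤ ℓ → IsZAntler G z (full G) (prefixUnion G Cs k) (prefixUnion G Fs k)
  prefix-z-antler {z} {Cs = Cs} {Fs} _ zero _ =
    subst₂ (IsZAntler G z (full G)) (sym (prefixUnion-zero Cs)) (sym (prefixUnion-zero Fs)) (empty-z-antler z)
  prefix-z-antler {z} {ℓ} {Cs} {Fs} seq@(_ , _ , _ , antler) (suc k) k<ℓ =
    subst₂ (IsZAntler G z (full G)) (sym (prefixUnion-suc Cs i i≡k)) (sym (prefixUnion-suc Fs i i≡k))
      (z-antler-∪ (prefix-z-antler seq k (<⇒≤ k<ℓ)) next)
    where
    i : Fin ℓ
    i = fromℕ< k<ℓ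
    i≡k : toℕ i ≡ k
    i≡k = toℕ-fromℕ< k<ℓ
    next : IsZAntler G z (delete G (full G) (prefixUnion G Cs k ∪ prefixUnion G Fs k)) (Cs i) (Fs i)
    next = subst (λ Y → IsZAntler G z (delete G (full G) Y) (Cs i) (Fs i))
             (trans (cong (prefixUnion G (λ j → Cs j ∪ Fs j)) i≡k) (prefixUnion-∪ Cs Fs k))
             (antler i)

proposition27 : (z : ℕ) (G : Graph) (ℓ : ℕ)
    (Cs Fs : Fin ℓ → Subset (Graph.n G))
    → IsZAntlerSequence G z ℓ Cs Fs
    → ∀ (i : Fin ℓ)
    → IsZAntler G z (full G)
        (prefixUnion G Cs (suc (toℕ i)))
        (prefixUnion G Fs (suc (toℕ i)))
proposition27 z G ℓ Cs Fs seq i = prefix-z-antler G seq (suc (toℕ i)) (toℕ<n i)
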